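{- Let $G$ be a connected bipartite graph on $n\geq 4$ vertices that does not contain $K_{2,2}$ as a subgraph, and suppose $G\neq K_{1,n-1}$. Then $\operatorname{Z}(\overline{G})=n-3$.
   Context: All graphs are finite, simple and undirected. $\overline{G}$ denotes the complement of $G$ (same vertex set; distinct vertices adjacent iff not adjacent in $G$). $K_{r,s}$ is the complete bipartite graph with parts of sizes $r$ and $s$; $K_{1,n-1}$ is the star. Zero forcing: given an initial set $B\subseteq V(G)$ of blue vertices (all others white), a blue vertex with exactly one white neighbor may turn that neighbor blue; $B$ is a zero forcing set if repeated application makes all vertices blue. $\operatorname{Z}(G)$ is the minimum size of a zero forcing set of $G$. -}

module Defs where

open import Data.Nat using (ℕ; _≤_)
open import Data.Bool using (Bool; true; false; not; _∧_)
open import Data.Fin using (Fin)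
open import Data.Fin.Properties using (_≟_)
open import Data.Fin.Subset using (Subset; _∈_; ∣_∣)
open import Data.Product using (Σ; ∃; ∃-syntax; _×_; _,_)
open import Data.Sum using (_⊎_)
open import Relation.Nullary using (¬_)
open import Relation.Nullary.Decidable using (⌊_⌋)
open import Relation.Binary.PropositionalEquality using (_≡_; _≢_)
open import Function.Bundles using (_⇔_)

record Graph (n : ℕ) : Set where
  field
    adj    : Fin n → Fin n → Bool
    sym    : ∀ u v → adj u v ≡ adj v u
    irrefl : ∀ v → adj v v ≡ false
open Graph public

Adj : ∀ {n} → Graph n → Fin n → Fin n → Set
Adj G u v = adj G u v ≡ true

complement : ∀ {n} → Graph n → Graph n
complement {n} G = record { adj = cadj ; sym = csym ; irrefl = cirr }
  where
  cadj : Fin n → Fin n → Bool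
  cadj u v = not (adj G u v) ∧ not ⌊ u ≟ v ⌋
  csym : ∀ u v → cadj u v ≡ cadj v u
  csym u v with adj G u v | adj G v u | Graph.sym G u v | u ≟ v | v ≟ u
  ... | a | .a | _≡_.refl | Relation.Nullary.yes _ | Relation.Nullary.yes _ = _≡_.refl
  ... | a | .a | _≡_.refl | Relation.Nullary.no _ | Relation.Nullary.no _ = _≡_.refl
  ... | a | .a | _≡_.refl | Relation.Nullary.yes p | Relation.Nullary.no q = Data.Empty.⊥-elim (q (Relation.Binary.PropositionalEquality.sym p))
    where import Data.Empty
  ... | a | .a | _≡_.refl | Relation.Nullary.no q | Relation.Nullary.yes p = Data.Empty.⊥-elim (q (Relation.Binary.PropositionalEquality.sym p))
    where import Data.Empty
  cirr : ∀ v → cadj v v ≡ false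
  cirr v with v ≟ v
  ... | Relation.Nullary.yes _ = Data.Bool.Properties.∧-zeroʳ (not (adj G v v))
    where import Data.Bool.Properties
  ... | Relation.Nullary.no ¬p = Data.Empty.⊥-elim (¬p _≡_.refl)
    where import Data.Empty

data Walk {n} (G : Graph n) : Fin n → Fin n → Set where
  here  : ∀ {v} → Walk G v v
  there : ∀ {u w v} → Adj G u w → Walk G w v → Walk G u v

Connected : ∀ {n} → Graph n → Set
Connected G = ∀ u v → Walk G u v

Bipartite : ∀ {n} → Graph n → Set
Bipartite {n} G = Σ (Fin n → Bool) (λ c → ∀ u v → Adj G u v → c u ≢ c v)

-- G contains K_{2,2} as a (not necessarily induced) subgraph:
-- distinct a, b and distinct c, d with a,b both adjacent to c,d
-- (distinctness across the parts follows from irreflexivity).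
ContainsK22 : ∀ {n} → Graph n → Set
ContainsK22 G = ∃[ a ] ∃[ b ] ∃[ c ] ∃[ d ]
  (a ≢ b × c ≢ d × Adj G a c × Adj G a d × Adj G b c × Adj G b d)

IsStar : ∀ {n} → Graph n → Set
IsStar G = ∃[ z ] (∀ u v → Adj G u v ⇔ (u ≢ v × (u ≡ z ⊎ v ≡ z)))

-- Zero forcing: Forced G B v means v eventually becomes blue when
-- starting from blue set B (closure under the colour-change rule).
data Forced {n} (G : Graph n) (B : Subset n) : Fin n → Set where
  initial : ∀ {v} → v ∈ B → Forced G B v
  force   : ∀ {u v} → Forced G B u → Adj G u v →
            (∀ w → Adj G u w → w ≢ v → Forced G B w) →
            Forced G B v

IsZeroForcingSet : ∀ {n} → Graph n → Subset n → Set
IsZeroForcingSet G B = ∀ v → Forced G B v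

ZeroForcingNumber : ∀ {n} → Graph n → ℕ → Set
ZeroForcingNumber {n} G k =
  (∃[ B ] (IsZeroForcingSet G B × ∣ B ∣ ≡ k)) ×
  (∀ (B : Subset n) → IsZeroForcingSet G B → k ≤ ∣ B ∣)

-- Lower bound: let H be the complement of the K₂,₂-free graph G. Among any four
-- vertices of H there is a fort, a set no outside vertex can force into.  If some
-- u is G-adjacent to three of them, these three are a fort, since any other
-- vertex is G-adjacent to at most one of them; otherwise the four are a fort.
-- So a zero forcing set of H misses at most three vertices.
-- Upper bound: a connected bipartite graph without an induced P₄ is complete
-- bipartite, and a K₂,₂-free complete bipartite graph is a star.  So G has an
-- induced path a b c d, and with a, c, d white, b forces d, d forces a and a
-- forces c.

module Submission where

open import Defs hiding (sym)
open import Data.Nat using (ℕ; zero; suc; _+_; _∸_; _≤_; _<_; s≤s)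
open import Data.Nat.Properties using (_≤?_; ≰⇒>; +-suc; m+n≤o⇒n≤o; m≤n+o⇒m∸n≤o)
open import Data.Bool using (Bool; true; false)
open import Data.Bool.Properties using (¬-not) renaming (_≟_ to _≟ᵇ_)
open import Data.Fin using (Fin; zero; suc)
open import Data.Fin.Properties using (_≟_; any?)
open import Data.Fin.Subset using (Subset; inside; outside; ∣_∣; ∁; ⁅_⁆; _∪_)
  renaming (_∈_ to _∈ₛ_; _∉_ to _∉ₛ_)
open import Data.Fin.Subset.Properties
  using (drop-there; drop-not-there; ∪-identityˡ; x∈p∪q⁺; x∈p∪q⁻; x∈⁅x⁆; x∈⁅y⁆⇒x≡y;
         ∣⁅x⁆∣≡1; ∣∁p∣≡n∸∣p∣; x∉p⇒x∈∁p)
open import Data.List using (List; []; _∷_; length)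
open import Data.Vec using (_∷_; here)
open import Data.List.Membership.Propositional using (_∈_; _∉_; find)
open import Data.List.Relation.Unary.All as All using (All; []; _∷_)
open import Data.List.Relation.Unary.All.Properties using (¬All⇒Any¬)
open import Data.List.Relation.Unary.Any using (here; there)
open import Data.List.Relation.Unary.AllPairs using ([]; _∷_)
open import Data.List.Relation.Unary.Unique.Propositional using (Unique)
open import Data.Product using (∃-syntax; _×_; _,_; proj₁; proj₂)
open import Data.Sum using (_⊎_; inj₁; inj₂)
open import Data.Empty using (⊥; ⊥-elim)
open import Function using (_∘_; const)
open import Function.Bundles using (mk⇔)
open import Relation.Nullary using (¬_; Dec; yes; no; ¬?; contradiction)
open import Relation.Nullary.Decidable using (_×-dec_; _→-dec_; ¬¬-excluded-middle)
open import Relation.Unary using (Decidable)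
open import Relation.Binary.PropositionalEquality
  using (_≡_; _≢_; refl; sym; trans; cong; subst; ≢-sym; module ≡-Reasoning)

private
  variable
    n : ℕ

≢-both⇒≡ : {x y z : Bool} → x ≢ z → y ≢ z → x ≡ y
≢-both⇒≡ x≢z y≢z = trans (¬-not x≢z) (sym (¬-not y≢z))

∣⁅x⁆∪p∣≡1+∣p∣ : ∀ {x} {p : Subset n} → x ∉ₛ p → ∣ ⁅ x ⁆ ∪ p ∣ ≡ suc ∣ p ∣
∣⁅x⁆∪p∣≡1+∣p∣ {x = zero}  {inside  ∷ p} x∉p = contradiction here x∉p
∣⁅x⁆∪p∣≡1+∣p∣ {x = zero}  {outside ∷ p} _   = cong (suc ∘ ∣_∣) (∪-identityˡ p)
∣⁅x⁆∪p∣≡1+∣p∣ {x = suc x} {inside  ∷ p} x∉p = cong suc (∣⁅x⁆∪p∣≡1+∣p∣ (drop-not-there x∉p))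
∣⁅x⁆∪p∣≡1+∣p∣ {x = suc x} {outside ∷ p} x∉p = ∣⁅x⁆∪p∣≡1+∣p∣ (drop-not-there x∉p)

∉-⁅⁆∪⁻ : ∀ {x y} {p : Subset n} → y ∉ₛ ⁅ x ⁆ ∪ p → y ≢ x × y ∉ₛ p
∉-⁅⁆∪⁻ {x = x} y∉ = (λ { refl → y∉ (x∈p∪q⁺ (inj₁ (x∈⁅x⁆ x))) }) , y∉ ∘ x∈p∪q⁺ ∘ inj₂

∉-⁅⁆∪⁺ : ∀ {x y} {p : Subset n} → y ≢ x → y ∉ₛ p → y ∉ₛ ⁅ x ⁆ ∪ p
∉-⁅⁆∪⁺ {x = x} {p = p} y≢x y∉p y∈ with x∈p∪q⁻ ⁅ x ⁆ p y∈
... | inj₁ y∈⁅x⁆ = y≢x (x∈⁅y⁆⇒x≡y x y∈⁅x⁆)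
... | inj₂ y∈p  = y∉p y∈p

∣⁅x,y,z⁆∣≡3 : ∀ {x y z : Fin n} → x ≢ y → x ≢ z → y ≢ z → ∣ ⁅ x ⁆ ∪ ⁅ y ⁆ ∪ ⁅ z ⁆ ∣ ≡ 3
∣⁅x,y,z⁆∣≡3 {x = x} {y} {z} x≢y x≢z y≢z = begin
  ∣ ⁅ x ⁆ ∪ ⁅ y ⁆ ∪ ⁅ z ⁆ ∣ ≡⟨ ∣⁅x⁆∪p∣≡1+∣p∣ (∉-⁅⁆∪⁺ x≢y (x≢z ∘ x∈⁅y⁆⇒x≡y z)) ⟩
  suc ∣ ⁅ y ⁆ ∪ ⁅ z ⁆ ∣     ≡⟨ cong suc (∣⁅x⁆∪p∣≡1+∣p∣ (y≢z ∘ x∈⁅y⁆⇒x≡y z)) ⟩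
  suc (suc ∣ ⁅ z ⁆ ∣)       ≡⟨ cong (2 +_) (∣⁅x⁆∣≡1 z) ⟩
  3                         ∎
  where open ≡-Reasoning

∃∉ : ∀ (p : Subset n) → ∣ p ∣ < n → ∃[ x ] x ∉ₛ p
∃∉ (outside ∷ p) _        = zero , λ ()
∃∉ (inside  ∷ p) (s≤s lt) = let x , x∉p = ∃∉ p lt in suc x , x∉p ∘ drop-there

distinct-outside : ∀ k (p : Subset n) → k + ∣ p ∣ ≤ n →
  ∃[ xs ] (length xs ≡ k × Unique xs × All (_∉ₛ p) xs)
distinct-outside zero    p _    = [] , refl , [] , []
distinct-outside {n} (suc k) p room =
  let room₁ = subst (_≤ n) (sym (+-suc k ∣ p ∣)) room
      x , x∉p = ∃∉ p (m+n≤o⇒n≤o k room₁)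
      room₂ = subst (λ s → k + s ≤ n) (sym (∣⁅x⁆∪p∣≡1+∣p∣ x∉p)) room₁
      xs , length≡k , unique , xs∉ = distinct-outside k (⁅ x ⁆ ∪ p) room₂
  in x ∷ xs , cong suc length≡k
   , All.map (≢-sym ∘ proj₁ ∘ ∉-⁅⁆∪⁻) xs∉ ∷ unique
   , x∉p ∷ All.map (proj₂ ∘ ∉-⁅⁆∪⁻) xs∉

IsFort : Graph n → (Fin n → Set) → Set
IsFort H F = ∀ {u v} → ¬ F u → F v → Adj H u v → ∃[ w ] (F w × w ≢ v × Adj H u w)

fort-unforced : ∀ {H : Graph n} {B F} → IsFort H F → (∀ {w} → F w → w ∉ₛ B) →
                ∀ {v} → F v → ¬ Forced H B v
fort-unforced fort white Fv (initial v∈B) = white Fv v∈B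
fort-unforced fort white Fv (force {u} u-blue u~v others-blue) =
  ¬¬-excluded-middle λ where
    (yes Fu) → fort-unforced fort white Fu u-blue
    (no ¬Fu) → let w , Fw , w≢v , u~w = fort ¬Fu Fv u~v
               in fort-unforced fort white Fw (others-blue w u~w w≢v)

zero-forcing-set-meets-fort : ∀ {H : Graph n} {B xs} → IsZeroForcingSet H B →
  IsFort H (_∈ xs) → ∀ {v} → v ∈ xs → ¬ All (_∉ₛ B) xs
zero-forcing-set-meets-fort zf fort {v} v∈xs white =
  fort-unforced fort (All.lookup white) v∈xs (zf v)

-- In a bipartite graph the remaining non-edges ac, bd and a ≢ d of an
-- induced path are forced by the colouring.
IsInducedP₄ : Graph n → Fin n → Fin n → Fin n → Fin n → Set
IsInducedP₄ G a b c d = Adj G a b × Adj G b c × Adj G c d × a ≢ c × b ≢ d × ¬ Adj G a d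

HasInducedP₄ : Graph n → Set
HasInducedP₄ G = ∃[ a ] ∃[ b ] ∃[ c ] ∃[ d ] IsInducedP₄ G a b c d

module _ (G : Graph n) where

  Adj⇒≢ : ∀ {u v} → Adj G u v → u ≢ v
  Adj⇒≢ {u} u~v refl = contradiction (trans (sym u~v) (irrefl G u)) λ ()

  Adj-sym : ∀ {u v} → Adj G u v → Adj G v u
  Adj-sym {u} {v} u~v = trans (Graph.sym G v u) u~v

  Adjᶜ⇒¬Adj : ∀ {u v} → Adj (complement G) u v → ¬ Adj G u v
  Adjᶜ⇒¬Adj {u} {v} u~ᶜv u~v with adj G u v
  Adjᶜ⇒¬Adj () refl | true

  Adjᶜ⇒≢ : ∀ {u v} → Adj (complement G) u v → u ≢ v
  Adjᶜ⇒≢ {u} {v} u~ᶜv u≡v with adj G u v | u ≟ v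
  Adjᶜ⇒≢ () _ | true  | _
  Adjᶜ⇒≢ () _ | false | yes _
  Adjᶜ⇒≢ _ u≡v | false | no u≢v = u≢v u≡v

  ¬Adj⇒Adjᶜ : ∀ {u v} → u ≢ v → ¬ Adj G u v → Adj (complement G) u v
  ¬Adj⇒Adjᶜ {u} {v} u≢v u≁v with adj G u v | u ≟ v
  ... | true  | _     = contradiction refl u≁v
  ... | false | yes u≡v = contradiction u≡v u≢v
  ... | false | no _  = refl

  Adj-except? : ∀ u v → Decidable (λ w → w ≢ v → Adj G u w)
  Adj-except? u v w = ¬? (w ≟ v) →-dec (adj G u w ≟ᵇ true)

  complement-fort : ∀ (xs : List (Fin n)) →
    (∀ {u v} → u ∉ xs → v ∈ xs → Adj (complement G) u v →
       ¬ All (λ w → w ≢ v → Adj G u w) xs) →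
    IsFort (complement G) (_∈ xs)
  complement-fort xs blocked {u} {v} u∉xs v∈xs u~ᶜv
    with find (¬All⇒Any¬ (Adj-except? u v) xs (blocked u∉xs v∈xs u~ᶜv))
  ... | w , w∈xs , ¬[w≢v⇒u~w] =
    w , w∈xs , (λ w≡v → ¬[w≢v⇒u~w] (λ w≢v → contradiction w≡v w≢v))
      , ¬Adj⇒Adjᶜ (λ { refl → u∉xs w∈xs }) (¬[w≢v⇒u~w] ∘ const)

  module _ (noK22 : ¬ ContainsK22 G) where

    -- Two vertices u ≢ c adjacent to two common vertices would span a K₂,₂.
    common-neighbourhood-fort : ∀ {c x y z} → Unique (x ∷ y ∷ z ∷ []) →
      All (Adj G c) (x ∷ y ∷ z ∷ []) → IsFort (complement G) (_∈ x ∷ y ∷ z ∷ [])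
    common-neighbourhood-fort {c} {x} {y} {z}
      ((x≢y ∷ x≢z ∷ []) ∷ (y≢z ∷ []) ∷ [] ∷ []) (c~x ∷ c~y ∷ c~z ∷ []) =
      complement-fort _ blocked
      where
      c≢ : ∀ {u v} → Adj (complement G) u v → Adj G c v → c ≢ u
      c≢ u~ᶜv c~v refl = Adjᶜ⇒¬Adj u~ᶜv c~v

      blocked : ∀ {u v} → u ∉ x ∷ y ∷ z ∷ [] → v ∈ x ∷ y ∷ z ∷ [] → Adj (complement G) u v →
                ¬ All (λ w → w ≢ v → Adj G u w) (x ∷ y ∷ z ∷ [])
      blocked _ (here refl) u~ᶜx (_ ∷ u~y ∷ u~z ∷ []) =
        noK22 (c , _ , y , z , c≢ u~ᶜx c~x , y≢z , c~y , c~z , u~y (≢-sym x≢y) , u~z (≢-sym x≢z))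
      blocked _ (there (here refl)) u~ᶜy (u~x ∷ _ ∷ u~z ∷ []) =
        noK22 (c , _ , x , z , c≢ u~ᶜy c~y , x≢z , c~x , c~z , u~x x≢y , u~z (≢-sym y≢z))
      blocked _ (there (there (here refl))) u~ᶜz (u~x ∷ u~y ∷ _ ∷ []) =
        noK22 (c , _ , x , y , c≢ u~ᶜz c~z , x≢y , c~x , c~y , u~x x≢z , u~y y≢z)

    zero-forcing-set-meets-four : ∀ {B a b c d} → IsZeroForcingSet (complement G) B →
      Unique (a ∷ b ∷ c ∷ d ∷ []) → ¬ All (_∉ₛ B) (a ∷ b ∷ c ∷ d ∷ [])
    zero-forcing-set-meets-four {B} {a} {b} {c} {d} zf
      ((a≢b ∷ a≢c ∷ a≢d ∷ []) ∷ (b≢c ∷ b≢d ∷ []) ∷ (c≢d ∷ []) ∷ [] ∷ [])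
      white@(a∉B ∷ b∉B ∷ c∉B ∷ d∉B ∷ []) =
      ¬¬-excluded-middle cases
      where
      xs = a ∷ b ∷ c ∷ d ∷ []

      Blocked : Set
      Blocked = ∃[ u ] ∃[ v ] (u ∉ xs × v ∈ xs × Adj (complement G) u v ×
                               All (λ w → w ≢ v → Adj G u w) xs)

      triple : ∀ {u x y z} → x ≢ y → x ≢ z → y ≢ z → Adj G u x → Adj G u y → Adj G u z →
               x ∉ₛ B → y ∉ₛ B → z ∉ₛ B → ⊥
      triple x≢y x≢z y≢z u~x u~y u~z x∉B y∉B z∉B =
        zero-forcing-set-meets-fort zf
          (common-neighbourhood-fort ((x≢y ∷ x≢z ∷ []) ∷ (y≢z ∷ []) ∷ [] ∷ []) (u~x ∷ u~y ∷ u~z ∷ []))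
          (here refl) (x∉B ∷ y∉B ∷ z∉B ∷ [])

      refute-blocked : ∀ {u v} → v ∈ xs → ¬ All (λ w → w ≢ v → Adj G u w) xs
      refute-blocked (here refl) (_ ∷ u~b ∷ u~c ∷ u~d ∷ []) =
        triple b≢c b≢d c≢d (u~b (≢-sym a≢b)) (u~c (≢-sym a≢c)) (u~d (≢-sym a≢d)) b∉B c∉B d∉B
      refute-blocked (there (here refl)) (u~a ∷ _ ∷ u~c ∷ u~d ∷ []) =
        triple a≢c a≢d c≢d (u~a a≢b) (u~c (≢-sym b≢c)) (u~d (≢-sym b≢d)) a∉B c∉B d∉B
      refute-blocked (there (there (here refl))) (u~a ∷ u~b ∷ _ ∷ u~d ∷ []) =
        triple a≢b a≢d b≢d (u~a a≢c) (u~b b≢c) (u~d (≢-sym c≢d)) a∉B b∉B d∉B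
      refute-blocked (there (there (there (here refl)))) (u~a ∷ u~b ∷ u~c ∷ _ ∷ []) =
        triple a≢b a≢c b≢c (u~a a≢d) (u~b b≢d) (u~c c≢d) a∉B b∉B c∉B

      cases : Dec Blocked → ⊥
      cases (yes (_ , _ , _ , v∈xs , _ , rest)) = refute-blocked v∈xs rest
      cases (no unblocked) =
        zero-forcing-set-meets-fort zf
          (complement-fort xs λ u∉ v∈ u~ᶜv rest → unblocked (_ , _ , u∉ , v∈ , u~ᶜv , rest))
          (here refl) white

    zero-forcing-set-≥ : ∀ {B} → IsZeroForcingSet (complement G) B → n ≤ 3 + ∣ B ∣
    zero-forcing-set-≥ {B} zf with n ≤? 3 + ∣ B ∣
    ... | yes n≤3+∣B∣ = n≤3+∣B∣
    ... | no n≰3+∣B∣ with distinct-outside 4 B (≰⇒> n≰3+∣B∣)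
    ... | _ ∷ _ ∷ _ ∷ _ ∷ [] , refl , unique , white =
      ⊥-elim (zero-forcing-set-meets-four zf unique white)

  hasInducedP₄? : Dec (HasInducedP₄ G)
  hasInducedP₄? = any? λ a → any? λ b → any? λ c → any? λ d →
    Adj? a b ×-dec Adj? b c ×-dec Adj? c d ×-dec ¬? (a ≟ c) ×-dec ¬? (b ≟ d) ×-dec ¬? (Adj? a d)
    where
    Adj? : ∀ u v → Dec (Adj G u v)
    Adj? u v = adj G u v ≟ᵇ true

  module _ {col : Fin n → Bool} (proper : ∀ u v → Adj G u v → col u ≢ col v) where

    Adj-Adj⇒same-colour : ∀ {x y z} → Adj G x y → Adj G y z → col x ≡ col z
    Adj-Adj⇒same-colour x~y y~z = ≢-both⇒≡ (proper _ _ x~y) (≢-sym (proper _ _ y~z))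

    same-colour⇒¬Adj : ∀ {x y} → col x ≡ col y → ¬ Adj G x y
    same-colour⇒¬Adj same x~y = proper _ _ x~y same

    induced-P₄-ends-≢ : ∀ {a b c d} → IsInducedP₄ G a b c d → a ≢ d
    induced-P₄-ends-≢ (a~b , b~c , c~d , _) refl = proper _ _ c~d (sym (Adj-Adj⇒same-colour a~b b~c))

    induced-P₄⇒zero-forcing-set : ∀ {a b c d} → IsInducedP₄ G a b c d →
      IsZeroForcingSet (complement G) (∁ (⁅ a ⁆ ∪ ⁅ c ⁆ ∪ ⁅ d ⁆))
    induced-P₄⇒zero-forcing-set {a} {b} {c} {d} P₄@(a~b , b~c , c~d , a≢c , b≢d , a≁d) = forced
      where
      B = ∁ (⁅ a ⁆ ∪ ⁅ c ⁆ ∪ ⁅ d ⁆)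
      H = complement G

      a≢b = Adj⇒≢ a~b
      b≢c = Adj⇒≢ b~c
      a≢d = induced-P₄-ends-≢ P₄

      blue : ∀ {v} → v ≢ a → v ≢ c → v ≢ d → Forced H B v
      blue v≢a v≢c v≢d = initial (x∉p⇒x∈∁p (∉-⁅⁆∪⁺ v≢a (∉-⁅⁆∪⁺ v≢c (v≢d ∘ x∈⁅y⁆⇒x≡y d))))

      d-forced : Forced H B d
      d-forced =
        force (blue (≢-sym a≢b) b≢c b≢d)
              (¬Adj⇒Adjᶜ b≢d (same-colour⇒¬Adj (Adj-Adj⇒same-colour b~c c~d)))
              λ w b~ᶜw w≢d → blue (λ { refl → Adjᶜ⇒¬Adj b~ᶜw (Adj-sym a~b) })
                                  (λ { refl → Adjᶜ⇒¬Adj b~ᶜw b~c }) w≢d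

      a-forced : Forced H B a
      a-forced =
        force d-forced (¬Adj⇒Adjᶜ (≢-sym a≢d) (a≁d ∘ Adj-sym))
              λ w d~ᶜw w≢a → blue w≢a (λ { refl → Adjᶜ⇒¬Adj d~ᶜw (Adj-sym c~d) })
                                  (≢-sym (Adjᶜ⇒≢ d~ᶜw))

      c-forced : Forced H B c
      c-forced =
        force a-forced (¬Adj⇒Adjᶜ a≢c (same-colour⇒¬Adj (Adj-Adj⇒same-colour a~b b~c))) others
        where
        others : ∀ w → Adj H a w → w ≢ c → Forced H B w
        others w a~ᶜw w≢c with w ≟ d
        ... | yes refl = d-forced
        ... | no w≢d   = blue (≢-sym (Adjᶜ⇒≢ a~ᶜw)) w≢c w≢d

      forced : IsZeroForcingSet H B
      forced v with v ≟ a | v ≟ c | v ≟ d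
      ... | yes refl | _        | _        = a-forced
      ... | no _     | yes refl | _        = c-forced
      ... | no _     | no _     | yes refl = d-forced
      ... | no v≢a   | no v≢c   | no v≢d   = blue v≢a v≢c v≢d

    induced-P₄⇒zero-forcing-set-of-size : HasInducedP₄ G →
      ∃[ B ] (IsZeroForcingSet (complement G) B × ∣ B ∣ ≡ n ∸ 3)
    induced-P₄⇒zero-forcing-set-of-size (a , b , c , d , P₄@(_ , _ , c~d , a≢c , _)) =
      ∁ W , induced-P₄⇒zero-forcing-set P₄ ,
      trans (∣∁p∣≡n∸∣p∣ W) (cong (n ∸_) (∣⁅x,y,z⁆∣≡3 a≢c (induced-P₄-ends-≢ P₄) (Adj⇒≢ c~d)))
      where
      W = ⁅ a ⁆ ∪ ⁅ c ⁆ ∪ ⁅ d ⁆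

    -- A shortest walk between the two colour classes has length 1: the first
    -- three steps of a longer one would form an induced P₄ or a shortcut.
    P₄-free⇒complete-bipartite : ¬ HasInducedP₄ G →
      ∀ {u v} → Walk G u v → col u ≢ col v → Adj G u v
    P₄-free⇒complete-bipartite _ here u≢v = contradiction refl u≢v
    P₄-free⇒complete-bipartite _ (there u~v here) _ = u~v
    P₄-free⇒complete-bipartite noP₄ {u} {v} (there {w = w} u~w (there {w = w′} w~w′ walk)) u≢v
      with P₄-free⇒complete-bipartite noP₄ walk (u≢v ∘ trans (Adj-Adj⇒same-colour u~w w~w′))
    ... | w′~v with u ≟ w′ | w ≟ v | adj G u v ≟ᵇ true
    ...   | yes refl | _        | _          = w′~v
    ...   | no _     | yes refl | _          = u~w
    ...   | no _     | no _     | yes u~v    = u~v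
    ...   | no u≢w′  | no w≢v   | no u≁v     = ⊥-elim (noP₄ (u , w , w′ , v , u~w , w~w′ , w′~v , u≢w′ , w≢v , u≁v))

    module _ (complete : ∀ {u v} → col u ≢ col v → Adj G u v) where

      singleton-colour-class⇒star : ∀ {z} → (∀ {p} → p ≢ z → col p ≢ col z) → IsStar G
      singleton-colour-class⇒star {z} alone = z , λ u v → mk⇔ (to u v) (from u v)
        where
        to : ∀ u v → Adj G u v → u ≢ v × (u ≡ z ⊎ v ≡ z)
        to u v u~v with u ≟ z | v ≟ z
        ... | yes u≡z | _       = Adj⇒≢ u~v , inj₁ u≡z
        ... | no _    | yes v≡z = Adj⇒≢ u~v , inj₂ v≡z
        ... | no u≢z  | no v≢z  = contradiction (≢-both⇒≡ (alone u≢z) (alone v≢z)) (proper u v u~v)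

        from : ∀ u v → u ≢ v × (u ≡ z ⊎ v ≡ z) → Adj G u v
        from u v (u≢v , inj₁ refl) = complete (≢-sym (alone (≢-sym u≢v)))
        from u v (u≢v , inj₂ refl) = complete (alone u≢v)

      -- If x has a partner p in its colour class, then x and p share all of
      -- y's colour class, which must therefore be {y}.
      K22-free⇒star : ¬ ContainsK22 G → ∀ {x y} → Adj G x y → IsStar G
      K22-free⇒star noK22 {x} {y} x~y with any? (λ p → ¬? (p ≟ x) ×-dec (col p ≟ᵇ col x))
      ... | no x-alone = singleton-colour-class⇒star λ p≢x same → x-alone (_ , p≢x , same)
      ... | yes (p , p≢x , p∼x) = singleton-colour-class⇒star λ {q} q≢y q∼y →
        let x≁y = proper x y x~y in
        noK22 (x , p , y , q , ≢-sym p≢x , ≢-sym q≢y , x~y ,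
               complete (λ x∼q → x≁y (trans x∼q q∼y)) ,
               complete (λ p∼y → x≁y (trans (sym p∼x) p∼y)) ,
               complete (λ p∼q → x≁y (trans (sym p∼x) (trans p∼q q∼y))))

proposition2p4 : (n : ℕ) → 4 ≤ n → (G : Graph n) →
    Connected G → Bipartite G → ¬ ContainsK22 G → ¬ IsStar G →
    ZeroForcingNumber (complement G) (n ∸ 3)
proposition2p4 n@(suc (suc _)) (s≤s (s≤s _)) G connected (col , proper) noK22 notStar =
  upper , λ B zf → m≤n+o⇒m∸n≤o n 3 (zero-forcing-set-≥ G noK22 zf)
  where
  edge : ∃[ y ] Adj G zero y
  edge with connected zero (suc zero)
  ... | there 0~y _ = _ , 0~y

  upper : ∃[ B ] (IsZeroForcingSet (complement G) B × ∣ B ∣ ≡ n ∸ 3)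
  upper with hasInducedP₄? G
  ... | yes P₄ = induced-P₄⇒zero-forcing-set-of-size G proper P₄
  ... | no noP₄ = contradiction
    (K22-free⇒star G proper (P₄-free⇒complete-bipartite G proper noP₄ (connected _ _)) noK22 (proj₂ edge))
    notStar
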